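{- Suppose $A\subseteq\mathbb{N}$ with $|A|=k$. If $|AA|\le 3k-4$, then $|A+A|=(k^2+k)/2$. In particular, $SP(k)\ge 3k-3$ for all $k\in\mathbb{N}$.
   Context: $\mathbb{N}$ denotes the positive integers. $A+A=\{a+b:a,b\in A\}$, $AA=\{ab:a,b\in A\}$. For $k\in\mathbb{N}$, $SP(k)$ is the minimum of $\max\{|A+A|,|AA|\}$ over all $A\subseteq\mathbb{N}$ with $|A|=k$. -}

module Defs where

open import Data.Nat using (ℕ; _+_; _*_; _≟_)
open import Data.List using (List; length; deduplicate; cartesianProductWith)

-- A finite set A ⊆ ℕ is represented by a duplicate-free list (Unique) of its
-- elements; its cardinality |A| is the length of the list.

sumset : List ℕ → List ℕ
sumset A = deduplicate _≟_ (cartesianProductWith _+_ A A)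

prodset : List ℕ → List ℕ
prodset A = deduplicate _≟_ (cartesianProductWith _*_ A A)

card+ : List ℕ → ℕ
card+ A = length (sumset A)

card* : List ℕ → ℕ
card* A = length (prodset A)

-- If A is not a Sidon set, some sum in A + A has two different representations
-- a + b = c + d.  Send n to the lattice point (E n , ν_p n), where E is an additive
-- code of the prime factorisation that is injective on A and ν_p is the p-adic
-- valuation: products correspond to sums of points, so |AA| is the size of the sumset
-- of the image.  By the strict ultrametric property ν_p (x + y) = min (ν_p x , ν_p y)
-- for ν_p x ≠ ν_p y, a prime p separating two of a, b, c, d (for a = b, one separating
-- the odd parts of c and a, or p = 2 if these agree) puts A in non-collinear position:
-- a line through the image would not be horizontal, so ν_p would be injective on A,
-- which the collision forbids.  Freiman's lemma then gives |AA| ≥ 3|A| − 3: remove the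
-- point v with the largest first coordinate; if the rest is not collinear, v·v and v
-- times the two extreme points seen from v are new products, and if it is collinear,
-- v times every remaining point is new while the rest has at least 2(|A| − 1) − 1
-- products already.

module Submission where

-- Orientation in the integer plane

module Plane where

  open import Data.Integer
  open import Data.Integer.Properties using (i-j≡0⇒i≡j; i≡j⇒i-j≡0; *-zeroʳ; i*j≡0⇒i≡0∨j≡0; pos-*)
  open import Data.Integer.Tactic.RingSolver using (solve-∀)
  import Data.Nat as ℕ
  open import Data.Product using (_×_; _,_; proj₁; proj₂)
  open import Data.Sum using ([_,_]′; inj₁)
  open import Function using (id)
  open import Relation.Nullary using (contradiction)
  open import Relation.Binary.PropositionalEquality

  Point : Set
  Point = ℤ × ℤ

  _⊕_ : Point → Point → Point
  (x₁ , y₁) ⊕ (x₂ , y₂) = (x₁ + x₂ , y₁ + y₂)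

  reflect : Point → Point
  reflect (x , y) = (x , - y)

  opaque
    orient : Point → Point → Point → ℤ
    orient (x₀ , y₀) (x₁ , y₁) (x₂ , y₂) = (x₁ - x₀) * (y₂ - y₀) - (x₂ - x₀) * (y₁ - y₀)

  opaque
    unfolding orient

    orient-antisym : ∀ o a b → orient o a b ≡ - orient o b a
    orient-antisym (x₀ , y₀) (x₁ , y₁) (x₂ , y₂) = identity x₀ y₀ x₁ y₁ x₂ y₂
      where
      identity : ∀ x₀ y₀ x₁ y₁ x₂ y₂ →
        (x₁ - x₀) * (y₂ - y₀) - (x₂ - x₀) * (y₁ - y₀) ≡ - ((x₂ - x₀) * (y₁ - y₀) - (x₁ - x₀) * (y₂ - y₀))
      identity = solve-∀

    orient-degenerate : ∀ o a → orient o a a ≡ 0ℤ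
    orient-degenerate (x₀ , y₀) (x₁ , y₁) = identity x₀ y₀ x₁ y₁
      where
      identity : ∀ x₀ y₀ x₁ y₁ → (x₁ - x₀) * (y₁ - y₀) - (x₁ - x₀) * (y₁ - y₀) ≡ 0ℤ
      identity = solve-∀

    orient-reflect : ∀ o a b → orient (reflect o) (reflect a) (reflect b) ≡ - orient o a b
    orient-reflect (x₀ , y₀) (x₁ , y₁) (x₂ , y₂) = identity x₀ y₀ x₁ y₁ x₂ y₂
      where
      identity : ∀ x₀ y₀ x₁ y₁ x₂ y₂ →
        (x₁ - x₀) * (- y₂ - - y₀) - (x₂ - x₀) * (- y₁ - - y₀) ≡ - ((x₁ - x₀) * (y₂ - y₀) - (x₂ - x₀) * (y₁ - y₀))
      identity = solve-∀

    orient-horizontal : ∀ x₀ y₀ x₁ x₂ y₂ → orient (x₀ , y₀) (x₁ , y₀) (x₂ , y₂) ≡ (x₁ - x₀) * (y₂ - y₀)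
    orient-horizontal = identity
      where
      identity : ∀ x₀ y₀ x₁ x₂ y₂ → (x₁ - x₀) * (y₂ - y₀) - (x₂ - x₀) * (y₀ - y₀) ≡ (x₁ - x₀) * (y₂ - y₀)
      identity = solve-∀

    orient-split : ∀ o a b c d → o ⊕ d ≡ b ⊕ c → orient o a b + orient o a c ≡ orient o a d
    orient-split o@(x₀ , y₀) a@(x₁ , y₁) b@(x₂ , y₂) c@(x₃ , y₃) d@(x₄ , y₄) o⊕d≡b⊕c =
      sym (i-j≡0⇒i≡j _ _ (begin
        orient o a d - (orient o a b + orient o a c)
          ≡⟨ expand x₀ y₀ x₁ y₁ x₂ y₂ x₃ y₃ x₄ y₄ ⟩
        (x₁ - x₀) * ((y₀ + y₄) - (y₂ + y₃)) - ((x₀ + x₄) - (x₂ + x₃)) * (y₁ - y₀)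
          ≡⟨ cong₂ (λ u w → (x₁ - x₀) * u - w * (y₁ - y₀))
                   (i≡j⇒i-j≡0 (cong proj₂ o⊕d≡b⊕c)) (i≡j⇒i-j≡0 (cong proj₁ o⊕d≡b⊕c)) ⟩
        (x₁ - x₀) * 0ℤ - 0ℤ * (y₁ - y₀)
          ≡⟨ cong (_- 0ℤ) (*-zeroʳ (x₁ - x₀)) ⟩
        0ℤ ∎))
      where
      open ≡-Reasoning
      expand : ∀ x₀ y₀ x₁ y₁ x₂ y₂ x₃ y₃ x₄ y₄ →
        (x₁ - x₀) * (y₄ - y₀) - (x₄ - x₀) * (y₁ - y₀) - ((x₁ - x₀) * (y₂ - y₀) - (x₂ - x₀) * (y₁ - y₀) + ((x₁ - x₀) * (y₃ - y₀) - (x₃ - x₀) * (y₁ - y₀)))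
        ≡ (x₁ - x₀) * ((y₀ + y₄) - (y₂ + y₃)) - ((x₀ + x₄) - (x₂ + x₃)) * (y₁ - y₀)
      expand = solve-∀

    orient-cyclic : ∀ v x y z →
      orient v y x * (proj₁ v - proj₁ z) + orient v z y * (proj₁ v - proj₁ x) ≡ orient v z x * (proj₁ v - proj₁ y)
    orient-cyclic (x₀ , y₀) (x₁ , y₁) (x₂ , y₂) (x₃ , y₃) = identity x₀ y₀ x₁ y₁ x₂ y₂ x₃ y₃
      where
      identity : ∀ x₀ y₀ x₁ y₁ x₂ y₂ x₃ y₃ →
        ((x₂ - x₀) * (y₁ - y₀) - (x₁ - x₀) * (y₂ - y₀)) * (x₀ - x₃) + ((x₃ - x₀) * (y₂ - y₀) - (x₂ - x₀) * (y₃ - y₀)) * (x₀ - x₁)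
        ≡ ((x₃ - x₀) * (y₁ - y₀) - (x₁ - x₀) * (y₃ - y₀)) * (x₀ - x₂)
      identity = solve-∀

    private
      on-line-identity : ∀ x₀ y₀ x₁ y₁ x₂ y₂ x₃ y₃ x₄ y₄ →
        (x₁ - x₀) * ((x₃ - x₂) * (y₄ - y₂) - (x₄ - x₂) * (y₃ - y₂))
        ≡ (x₃ - x₂) * (((x₁ - x₀) * (y₄ - y₀) - (x₄ - x₀) * (y₁ - y₀)) - ((x₁ - x₀) * (y₂ - y₀) - (x₂ - x₀) * (y₁ - y₀)))
        - (x₄ - x₂) * (((x₁ - x₀) * (y₃ - y₀) - (x₃ - x₀) * (y₁ - y₀)) - ((x₁ - x₀) * (y₂ - y₀) - (x₂ - x₀) * (y₁ - y₀)))
      on-line-identity = solve-∀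

    orient-on-line : ∀ {o a p q s} → proj₁ o ≢ proj₁ a →
                     orient o a p ≡ 0ℤ → orient o a q ≡ 0ℤ → orient o a s ≡ 0ℤ → orient p q s ≡ 0ℤ
    orient-on-line {o@(x₀ , y₀)} {a@(x₁ , y₁)} {p@(x₂ , y₂)} {q@(x₃ , y₃)} {s@(x₄ , y₄)} x₀≢x₁ p-on q-on s-on =
      [ (λ x₁-x₀≡0 → contradiction (sym (i-j≡0⇒i≡j x₁ x₀ x₁-x₀≡0)) x₀≢x₁) , id ]′ (i*j≡0⇒i≡0∨j≡0 (x₁ - x₀) scaled≡0)
      where
      vanish : ∀ {u w tp tq ts} → tp ≡ 0ℤ → tq ≡ 0ℤ → ts ≡ 0ℤ → u * (ts - tp) - w * (tq - tp) ≡ 0ℤ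
      vanish {u} {w} refl refl refl = cong₂ _-_ (*-zeroʳ u) (*-zeroʳ w)
      scaled≡0 : (x₁ - x₀) * orient p q s ≡ 0ℤ
      scaled≡0 = trans (on-line-identity x₀ y₀ x₁ y₁ x₂ y₂ x₃ y₃ x₄ y₄) (vanish {x₃ - x₂} {x₄ - x₂} p-on q-on s-on)

  *-pos : ∀ {i j} → 0ℤ < i → 0ℤ < j → 0ℤ < i * j
  *-pos {+[1+ _ ]} {+[1+ _ ]} _ _ = +<+ (ℕ.s≤s ℕ.z≤n)
  *-pos {+0} (+<+ ())
  *-pos {+[1+ _ ]} {+0} _ (+<+ ())

  *-nonNeg : ∀ {i j} → 0ℤ ≤ i → 0ℤ < j → 0ℤ ≤ i * j
  *-nonNeg {+ m} {+ n} _ _ = subst (0ℤ ≤_) (pos-* m n) (+≤+ ℕ.z≤n)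

  *-pos⁻¹ : ∀ {i j} → 0ℤ < j → 0ℤ < i * j → 0ℤ < i
  *-pos⁻¹ {+[1+ _ ]} _ _ = +<+ (ℕ.s≤s ℕ.z≤n)
  *-pos⁻¹ {+0} {+[1+ _ ]} _ (+<+ ())
  *-pos⁻¹ { -[1+ _ ]} {+[1+ _ ]} _ ()
  *-pos⁻¹ { -[1+ _ ]} {+0} (+<+ ())

  *-zero⁻¹ : ∀ {i j} → 0ℤ < j → i * j ≡ 0ℤ → i ≡ 0ℤ
  *-zero⁻¹ {i} {+[1+ _ ]} _ ij≡0 with i*j≡0⇒i≡0∨j≡0 i ij≡0
  ... | inj₁ i≡0 = i≡0
  *-zero⁻¹ {j = +0} (+<+ ())

  nonNeg-+-≡0 : ∀ {i j} → 0ℤ ≤ i → 0ℤ ≤ j → i + j ≡ 0ℤ → i ≡ 0ℤ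
  nonNeg-+-≡0 {+0} {+ _} _ _ _ = refl

open Plane

open import Defs
open import Data.Nat using (ℕ; zero; suc; pred; 2+; _+_; _*_; _∸_; _^_; _≤_; _<_; _⊓_; _⊔_; z≤n; s≤s;
                            _≟_; _≤?_; _<?_; z<s; NonZero; >-nonZero; >-nonZero⁻¹; ≢-nonZero⁻¹; nonTrivial⇒n>1)
open import Data.Nat.Properties
open import Data.Nat.Divisibility
open import Data.Nat.DivMod using (_/_; m*n/n≡m; /-monoˡ-≤)
open import Data.Nat.Induction using (<-rec)
open import Data.Nat.ListAction using (product)
open import Data.Nat.ListAction.Properties using (∈⇒≤product)
open import Data.Nat.Primality using (Prime; prime?; prime[2]; euclidsLemma; prime⇒nonTrivial; prime⇒nonZero)
open import Data.Nat.Primality.Factorisation using (factorise)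
open import Data.Nat.Tactic.RingSolver using (solve-∀)
open import Data.Integer as ℤ using (ℤ; 0ℤ)
import Data.Integer.Properties as ℤ
open import Data.List using (List; []; _∷_; length; map; _++_)
open import Data.List.Properties using (length-++; length-map)
open import Data.List.Membership.Propositional using (_∈_; _∉_; find; lose)
open import Data.List.Membership.Propositional.Properties
  using (∈-deduplicate⁺; ∈-deduplicate⁻; ∈-cartesianProductWith⁺; ∈-cartesianProductWith⁻;
         ∈-++⁺ˡ; ∈-++⁺ʳ; ∈-++⁻; ∈-map⁺; ∈-map⁻; ∈-length)
open import Data.List.Membership.DecPropositional _≟_ using (_∈?_)
open import Data.List.Relation.Binary.Subset.Propositional using (_⊆_)
open import Data.List.Relation.Unary.Any using (here; there; any?)
open import Data.List.Relation.Unary.All as All using (All; []; _∷_)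
open import Data.List.Relation.Unary.All.Properties using (All¬⇒¬Any)
open import Data.List.Relation.Unary.AllPairs using ([]; _∷_)
open import Data.List.Relation.Unary.Unique.Propositional using (Unique)
import Data.List.Relation.Unary.Unique.Propositional.Properties as Unique
open import Data.List.Relation.Unary.Unique.DecPropositional.Properties _≟_ using (deduplicate-!)
open import Data.Product using (∃; ∃-syntax; _×_; _,_)
open import Data.Sum using (_⊎_; inj₁; inj₂; [_,_]′)
open import Data.Empty using (⊥; ⊥-elim)
open import Function using (_∘_; id)
open import Relation.Nullary using (¬_; ¬?; Dec; yes; no; contradiction)
open import Relation.Nullary.Decidable using (_×-dec_; _⊎-dec_)
open import Relation.Binary.Definitions using (tri<; tri≈; tri>)
open import Relation.Binary.PropositionalEquality


private
  variable
    p n : ℕ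
    xs ys : List ℕ

record Removal {X : Set} (x : X) (ys : List X) : Set where
  field
    rest : List X
    rest-unique : Unique rest
    x∉rest : x ∉ rest
    length≡ : length ys ≡ suc (length rest)
    ⊆x∷rest : ys ⊆ x ∷ rest
    rest⊆ : rest ⊆ ys

remove : ∀ {X : Set} {ys : List X} {x} → Unique ys → x ∈ ys → Removal x ys
remove {ys = _ ∷ ys} (x∉ys ∷ ys!) (here refl) = record
  { rest = ys ; rest-unique = ys! ; x∉rest = All¬⇒¬Any x∉ys ; length≡ = refl
  ; ⊆x∷rest = λ z∈ → z∈ ; rest⊆ = there }
remove {ys = y ∷ ys} {x} (y∉ys ∷ ys!) (there x∈ys) = record
  { rest = y ∷ rest ; rest-unique = All.tabulate (All.lookup y∉ys ∘ rest⊆) ∷ rest-unique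
  ; x∉rest = x∉y∷rest ; length≡ = cong suc length≡ ; ⊆x∷rest = y∷ys⊆x∷y∷rest ; rest⊆ = y∷rest⊆y∷ys }
  where
  open Removal (remove ys! x∈ys)
  x∉y∷rest : x ∉ y ∷ rest
  x∉y∷rest (here refl) = All¬⇒¬Any y∉ys x∈ys
  x∉y∷rest (there x∈rest) = x∉rest x∈rest
  y∷ys⊆x∷y∷rest : y ∷ ys ⊆ x ∷ y ∷ rest
  y∷ys⊆x∷y∷rest (here z≡y) = there (here z≡y)
  y∷ys⊆x∷y∷rest (there z∈ys) with ⊆x∷rest z∈ys
  ... | here z≡x = here z≡x
  ... | there z∈rest = there (there z∈rest)
  y∷rest⊆y∷ys : y ∷ rest ⊆ y ∷ ys
  y∷rest⊆y∷ys (here z≡y) = here z≡y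
  y∷rest⊆y∷ys (there z∈rest) = there (rest⊆ z∈rest)

Unique⇒length-mono : Unique xs → xs ⊆ ys → length xs ≤ length ys
Unique⇒length-mono {[]} {[]} _ _ = z≤n
Unique⇒length-mono {_ ∷ _} {[]} _ xs⊆[] with () ← xs⊆[] (here refl)
Unique⇒length-mono {xs} {y ∷ ys} xs! xs⊆y∷ys with y ∈? xs
... | no y∉xs = m≤n⇒m≤1+n (Unique⇒length-mono xs! xs⊆ys)
  where
  xs⊆ys : xs ⊆ ys
  xs⊆ys {z} z∈xs with xs⊆y∷ys z∈xs
  ... | here refl = contradiction z∈xs y∉xs
  ... | there z∈ys = z∈ys
... | yes y∈xs = subst (_≤ suc (length ys)) (sym length≡) (s≤s (Unique⇒length-mono rest-unique rest⊆ys))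
  where
  open Removal (remove xs! y∈xs)
  rest⊆ys : rest ⊆ ys
  rest⊆ys {z} z∈rest with xs⊆y∷ys (rest⊆ z∈rest)
  ... | here refl = contradiction z∈rest x∉rest
  ... | there z∈ys = z∈ys

maximum : ∀ {C : Set} (R : C → C → Set) X → 0 < length X →
          (∀ {a b} → a ∈ X → b ∈ X → R a b ⊎ R b a) →
          (∀ {a b c} → a ∈ X → b ∈ X → c ∈ X → R a b → R b c → R a c) →
          ∃[ m ] m ∈ X × (∀ {z} → z ∈ X → R z m)
maximum R (x ∷ []) _ total _ = x , here refl , λ { (here refl) → [ id , id ]′ (total (here refl) (here refl)) }
maximum R (x ∷ y ∷ ys) _ total transitive
  with maximum R (y ∷ ys) (s≤s z≤n) (λ a b → total (there a) (there b)) (λ a b c → transitive (there a) (there b) (there c))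
... | m , m∈ , z≤m with total (here refl) (there m∈)
...   | inj₁ x≤m = m , there m∈ , λ where
          (here refl) → x≤m
          (there z∈) → z≤m z∈
...   | inj₂ m≤x = x , here refl , λ where
          (here refl) → [ id , id ]′ (total (here refl) (here refl))
          (there z∈) → transitive (there z∈) (there m∈) (here refl) (z≤m z∈) m≤x

∈-sumset⁺ : ∀ {A a b} → a ∈ A → b ∈ A → a + b ∈ sumset A
∈-sumset⁺ a∈A b∈A = ∈-deduplicate⁺ _≟_ (∈-cartesianProductWith⁺ _+_ a∈A b∈A)

∈-sumset⁻ : ∀ A {z} → z ∈ sumset A → ∃[ a ] ∃[ b ] a ∈ A × b ∈ A × z ≡ a + b
∈-sumset⁻ A = ∈-cartesianProductWith⁻ _+_ A A ∘ ∈-deduplicate⁻ _≟_ _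

∈-prodset⁺ : ∀ {A a b} → a ∈ A → b ∈ A → a * b ∈ prodset A
∈-prodset⁺ a∈A b∈A = ∈-deduplicate⁺ _≟_ (∈-cartesianProductWith⁺ _*_ a∈A b∈A)

∈-prodset⁻ : ∀ A {z} → z ∈ prodset A → ∃[ a ] ∃[ b ] a ∈ A × b ∈ A × z ≡ a * b
∈-prodset⁻ A = ∈-cartesianProductWith⁻ _*_ A A ∘ ∈-deduplicate⁻ _≟_ _

card+-≡-length : ∀ A {L} → Unique L → L ⊆ sumset A → sumset A ⊆ L → card+ A ≡ length L
card+-≡-length A L! L⊆A+A A+A⊆L =
  ≤-antisym (Unique⇒length-mono (deduplicate-! _) A+A⊆L) (Unique⇒length-mono L! L⊆A+A)

card*-extend : ∀ {B′ B E} → B′ ⊆ B → Unique E → E ⊆ prodset B →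
               (∀ {e x y} → e ∈ E → x ∈ B′ → y ∈ B′ → e ≢ x * y) →
               card* B′ + length E ≤ card* B
card*-extend {B′} {B} {E} B′⊆B E! E⊆BB E∉B′B′ =
  subst (_≤ card* B) (length-++ (prodset B′))
    (Unique⇒length-mono (Unique.++⁺ (deduplicate-! _) E! disjoint) B′B′++E⊆BB)
  where
  disjoint : ∀ {z} → ¬ (z ∈ prodset B′ × z ∈ E)
  disjoint (z∈B′B′ , z∈E) with ∈-prodset⁻ B′ z∈B′B′
  ... | x , y , x∈B′ , y∈B′ , z≡xy = E∉B′B′ z∈E x∈B′ y∈B′ z≡xy
  B′B′++E⊆BB : prodset B′ ++ E ⊆ prodset B
  B′B′++E⊆BB z∈ with ∈-++⁻ (prodset B′) z∈
  ... | inj₂ z∈E = E⊆BB z∈E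
  ... | inj₁ z∈B′B′ with ∈-prodset⁻ B′ z∈B′B′
  ...   | x , y , x∈B′ , y∈B′ , refl = ∈-prodset⁺ (B′⊆B x∈B′) (B′⊆B y∈B′)

-- Sidon sets

SamePair : ℕ → ℕ → ℕ → ℕ → Set
SamePair a b c d = (a ≡ c × b ≡ d) ⊎ (a ≡ d × b ≡ c)

IsSidon : List ℕ → Set
IsSidon A = ∀ {a b c d} → a ∈ A → b ∈ A → c ∈ A → d ∈ A → a + b ≡ c + d → SamePair a b c d

pairSums : List ℕ → List ℕ
pairSums [] = []
pairSums (x ∷ xs) = map (x +_) (x ∷ xs) ++ pairSums xs

2*length-pairSums : ∀ A → 2 * length (pairSums A) ≡ length A * length A + length A
2*length-pairSums [] = refl
2*length-pairSums (x ∷ xs) = begin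
  2 * length (map (x +_) (x ∷ xs) ++ pairSums xs)
    ≡⟨ cong (2 *_) (length-++ (map (x +_) (x ∷ xs))) ⟩
  2 * (length (map (x +_) (x ∷ xs)) + length (pairSums xs))
    ≡⟨ cong (λ n → 2 * (n + length (pairSums xs))) (length-map (x +_) (x ∷ xs)) ⟩
  2 * (suc k + length (pairSums xs))
    ≡⟨ *-distribˡ-+ 2 (suc k) (length (pairSums xs)) ⟩
  2 * suc k + 2 * length (pairSums xs)
    ≡⟨ cong (2 * suc k +_) (2*length-pairSums xs) ⟩
  2 * suc k + (k * k + k)
    ≡⟨ expand k ⟩
  suc k * suc k + suc k ∎
  where
  open ≡-Reasoning
  k : ℕ
  k = length xs
  expand : ∀ k → 2 * suc k + (k * k + k) ≡ suc k * suc k + suc k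
  expand = solve-∀

∈-pairSums⁺ : ∀ A {a b} → a ∈ A → b ∈ A → a + b ∈ pairSums A
∈-pairSums⁺ (x ∷ xs) (here refl) b∈ = ∈-++⁺ˡ (∈-map⁺ (x +_) b∈)
∈-pairSums⁺ (x ∷ xs) {a} (there a∈xs) (here refl) =
  subst (_∈ pairSums (x ∷ xs)) (+-comm x a) (∈-++⁺ˡ (∈-map⁺ (x +_) (there a∈xs)))
∈-pairSums⁺ (x ∷ xs) (there a∈xs) (there b∈xs) = ∈-++⁺ʳ (map (x +_) (x ∷ xs)) (∈-pairSums⁺ xs a∈xs b∈xs)

∈-pairSums⁻ : ∀ A {z} → z ∈ pairSums A → ∃[ a ] ∃[ b ] a ∈ A × b ∈ A × z ≡ a + b
∈-pairSums⁻ (x ∷ xs) z∈ with ∈-++⁻ (map (x +_) (x ∷ xs)) z∈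
... | inj₁ z∈x+A with ∈-map⁻ (x +_) z∈x+A
...   | b , b∈ , z≡x+b = x , b , here refl , b∈ , z≡x+b
∈-pairSums⁻ (x ∷ xs) z∈ | inj₂ z∈rest with ∈-pairSums⁻ xs z∈rest
...   | a , b , a∈ , b∈ , z≡a+b = a , b , there a∈ , there b∈ , z≡a+b

pairSums-unique : ∀ {A} → Unique A → IsSidon A → Unique (pairSums A)
pairSums-unique {[]} _ _ = []
pairSums-unique {x ∷ xs} x∷xs!@(_ ∷ xs!) sidon =
  Unique.++⁺ (Unique.map⁺ (+-cancelˡ-≡ x _ _) x∷xs!) (pairSums-unique xs! (λ a b c d → sidon (there a) (there b) (there c) (there d))) disjoint
  where
  x∉xs : x ∉ xs
  x∉xs = Unique.Unique[x∷xs]⇒x∉xs x∷xs!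
  disjoint : ∀ {z} → ¬ (z ∈ map (x +_) (x ∷ xs) × z ∈ pairSums xs)
  disjoint (z∈x+A , z∈rest) with ∈-map⁻ (x +_) z∈x+A | ∈-pairSums⁻ xs z∈rest
  ... | b , b∈ , refl | c , d , c∈ , d∈ , x+b≡c+d with sidon (here refl) b∈ (there c∈) (there d∈) x+b≡c+d
  ...   | inj₁ (refl , _) = x∉xs c∈
  ...   | inj₂ (refl , _) = x∉xs d∈

card+-Sidon : ∀ {A} → Unique A → IsSidon A → card+ A ≡ (length A * length A + length A) / 2
card+-Sidon {A} A! sidon = begin
  card+ A                                  ≡⟨ card+-≡-length A (pairSums-unique A! sidon) pairSums⊆A+A A+A⊆pairSums ⟩
  length (pairSums A)                      ≡⟨ m*n/n≡m (length (pairSums A)) 2 ⟨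
  length (pairSums A) * 2 / 2              ≡⟨ cong (_/ 2) (*-comm (length (pairSums A)) 2) ⟩
  2 * length (pairSums A) / 2              ≡⟨ cong (_/ 2) (2*length-pairSums A) ⟩
  (length A * length A + length A) / 2     ∎
  where
  open ≡-Reasoning
  pairSums⊆A+A : pairSums A ⊆ sumset A
  pairSums⊆A+A z∈ with ∈-pairSums⁻ A z∈
  ... | a , b , a∈ , b∈ , refl = ∈-sumset⁺ a∈ b∈
  A+A⊆pairSums : sumset A ⊆ pairSums A
  A+A⊆pairSums z∈ with ∈-sumset⁻ A z∈
  ... | a , b , a∈ , b∈ , refl = ∈-pairSums⁺ A a∈ b∈

record Collision (A : List ℕ) : Set where
  constructor collision
  field
    {a b c d} : ℕ
    a∈A : a ∈ A
    b∈A : b ∈ A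
    c∈A : c ∈ A
    d∈A : d ∈ A
    a+b≡c+d : a + b ≡ c + d
    ¬samePair : ¬ SamePair a b c d

samePair? : ∀ a b c d → Dec (SamePair a b c d)
samePair? a b c d = (a ≟ c ×-dec b ≟ d) ⊎-dec (a ≟ d ×-dec b ≟ c)

sidon-or-collision : ∀ A → IsSidon A ⊎ Collision A
sidon-or-collision A with any? (λ a → any? (λ b → any? (λ c → any? (λ d → a + b ≟ c + d ×-dec ¬? (samePair? a b c d)) A) A) A) A
... | yes any-a with find any-a
...   | a , a∈ , any-b with find any-b
...   | b , b∈ , any-c with find any-c
...   | c , c∈ , any-d with find any-d
...   | d , d∈ , (a+b≡c+d , ¬same) = inj₂ (collision a∈ b∈ c∈ d∈ a+b≡c+d ¬same)
sidon-or-collision A | no none = inj₁ sidon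
  where
  sidon : IsSidon A
  sidon {a} {b} {c} {d} a∈ b∈ c∈ d∈ a+b≡c+d with samePair? a b c d
  ... | yes same = same
  ... | no ¬same = contradiction (lose a∈ (lose b∈ (lose c∈ (lose d∈ (a+b≡c+d , ¬same))))) none

common⇒samePair : ∀ {a b c d} → a + b ≡ c + d → (a ≡ c ⊎ a ≡ d) ⊎ (b ≡ c ⊎ b ≡ d) → SamePair a b c d
common⇒samePair {a} {b} {c} {d} a+b≡c+d (inj₁ (inj₁ refl)) = inj₁ (refl , +-cancelˡ-≡ a b d a+b≡c+d)
common⇒samePair {a} {b} {c} {d} a+b≡c+d (inj₁ (inj₂ refl)) = inj₂ (refl , +-cancelˡ-≡ a b c (trans a+b≡c+d (+-comm c a)))
common⇒samePair {a} {b} {c} {d} a+b≡c+d (inj₂ (inj₁ refl)) = inj₂ (+-cancelʳ-≡ b a d (trans a+b≡c+d (+-comm b d)) , refl)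
common⇒samePair {a} {b} {c} {d} a+b≡c+d (inj₂ (inj₂ refl)) = inj₁ (+-cancelʳ-≡ b a c a+b≡c+d , refl)

-- p-adic valuations

prime⇒>1 : Prime p → 1 < p
prime⇒>1 {p} p-prime = nonTrivial⇒n>1 p {{prime⇒nonTrivial p-prime}}

record Decomposition (p n : ℕ) : Set where
  constructor decomposition
  field
    exponent cofactor : ℕ
    n≡p^e*m : n ≡ p ^ exponent * cofactor
    p∤cofactor : p ∤ cofactor

decompose : 1 < p → ∀ n → .{{NonZero n}} → Decomposition p n
decompose {p} 1<p = <-rec (λ n → .{{NonZero n}} → Decomposition p n) step
  where
  step : ∀ n → (∀ {q} → q < n → .{{NonZero q}} → Decomposition p q) → .{{NonZero n}} → Decomposition p n
  step n rec with p ∣? n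
  ... | no p∤n = decomposition 0 n (sym (+-identityʳ n)) p∤n
  ... | yes (divides zero n≡0) = contradiction n≡0 (≢-nonZero⁻¹ n)
  ... | yes (divides q@(suc _) n≡q*p) with rec (subst (q <_) (sym n≡q*p) (m<m*n q p 1<p))
  ... | decomposition e m q≡p^e*m p∤m = decomposition (suc e) m n≡ p∤m
    where
    n≡ : n ≡ p ^ suc e * m
    n≡ = begin
      n               ≡⟨ n≡q*p ⟩
      q * p           ≡⟨ cong (_* p) q≡p^e*m ⟩
      p ^ e * m * p   ≡⟨ rearrange (p ^ e) m p ⟩
      p * p ^ e * m   ∎
      where
      open ≡-Reasoning
      rearrange : ∀ a b c → a * b * c ≡ c * a * b
      rearrange = solve-∀

exponent-unique : 1 < p → ∀ {e f m m′} → p ^ e * m ≡ p ^ f * m′ → p ∤ m → p ∤ m′ → e ≡ f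
exponent-unique 1<p {zero} {zero} _ _ _ = refl
exponent-unique {p} 1<p {zero} {suc f} {m} {m′} eq p∤m _ =
  contradiction (subst (p ∣_) (trans (sym eq) (*-identityˡ m)) (∣m⇒∣m*n m′ (m∣m*n (p ^ f)))) p∤m
exponent-unique {p} 1<p {suc e} {zero} {m} {m′} eq _ p∤m′ =
  contradiction (subst (p ∣_) (trans eq (*-identityˡ m′)) (∣m⇒∣m*n m (m∣m*n (p ^ e)))) p∤m′
exponent-unique {p} 1<p {suc e} {suc f} {m} {m′} eq p∤m p∤m′ =
  cong suc (exponent-unique 1<p (*-cancelˡ-≡ _ _ p {{>-nonZero (<-trans z<s 1<p)}} p*-eq) p∤m p∤m′)
  where
  p*-eq : p * (p ^ e * m) ≡ p * (p ^ f * m′)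
  p*-eq = trans (sym (*-assoc p (p ^ e) m)) (trans eq (*-assoc p (p ^ f) m′))

-- ν p n is the exponent of p in n, with the junk value 0 unless p > 1 and n > 0.
ν : ℕ → ℕ → ℕ
ν p@(suc (suc _)) n@(suc _) = Decomposition.exponent (decompose {p} (s≤s (s≤s z≤n)) n)
ν _ _ = 0

ν-decomposition : 1 < p → ∀ n → .{{NonZero n}} → ∃[ m ] n ≡ p ^ ν p n * m × p ∤ m
ν-decomposition {p} (s≤s (s≤s _)) n@(suc _) = cofactor , n≡p^e*m , p∤cofactor
  where open Decomposition (decompose {p} (s≤s (s≤s z≤n)) n)

ν-unique : 1 < p → ∀ {n e m} → .{{NonZero n}} → n ≡ p ^ e * m → p ∤ m → ν p n ≡ e
ν-unique 1<p {n} n≡ p∤m with ν-decomposition 1<p n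
... | m′ , n≡′ , p∤m′ = exponent-unique 1<p (trans (sym n≡′) n≡) p∤m′ p∤m

ν-* : Prime p → ∀ a b → .{{NonZero a}} → .{{NonZero b}} → ν p (a * b) ≡ ν p a + ν p b
ν-* {p} p-prime a b with ν-decomposition (prime⇒>1 p-prime) a | ν-decomposition (prime⇒>1 p-prime) b
... | m , a≡ , p∤m | m′ , b≡ , p∤m′ = ν-unique (prime⇒>1 p-prime) {{m*n≢0 a b}} ab≡ p∤mm′
  where
  ab≡ : a * b ≡ p ^ (ν p a + ν p b) * (m * m′)
  ab≡ = begin
    a * b                                  ≡⟨ cong₂ _*_ a≡ b≡ ⟩
    p ^ ν p a * m * (p ^ ν p b * m′)       ≡⟨ interchange (p ^ ν p a) m (p ^ ν p b) m′ ⟩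
    p ^ ν p a * p ^ ν p b * (m * m′)       ≡⟨ cong (_* (m * m′)) (^-distribˡ-+-* p (ν p a) (ν p b)) ⟨
    p ^ (ν p a + ν p b) * (m * m′)         ∎
    where
    open ≡-Reasoning
    interchange : ∀ x u y w → x * u * (y * w) ≡ x * y * (u * w)
    interchange = solve-∀
  p∤mm′ : p ∤ m * m′
  p∤mm′ p∣mm′ with euclidsLemma m m′ p-prime p∣mm′
  ... | inj₁ p∣m = p∤m p∣m
  ... | inj₂ p∣m′ = p∤m′ p∣m′

ν-+-< : 1 < p → ∀ a b → .{{NonZero a}} → .{{NonZero b}} → ν p a < ν p b → ν p (a + b) ≡ ν p a
ν-+-< {p} 1<p a@(suc _) b νa<νb with ν-decomposition 1<p a | ν-decomposition 1<p b
... | m , a≡ , p∤m | m′ , b≡ , _ = ν-unique 1<p a+b≡ p∤sum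
  where
  e d : ℕ
  e = ν p a
  d = ν p b ∸ e
  a+b≡ : a + b ≡ p ^ e * (m + p ^ d * m′)
  a+b≡ = begin
    a + b                               ≡⟨ cong₂ _+_ a≡ b≡ ⟩
    p ^ e * m + p ^ ν p b * m′          ≡⟨ cong (λ f → p ^ e * m + p ^ f * m′) (m+[n∸m]≡n (<⇒≤ νa<νb)) ⟨
    p ^ e * m + p ^ (e + d) * m′        ≡⟨ cong (λ x → p ^ e * m + x * m′) (^-distribˡ-+-* p e d) ⟩
    p ^ e * m + p ^ e * p ^ d * m′      ≡⟨ factor (p ^ e) m (p ^ d) m′ ⟩
    p ^ e * (m + p ^ d * m′)            ∎
    where
    open ≡-Reasoning
    factor : ∀ x u y w → x * u + x * y * w ≡ x * (u + y * w)
    factor = solve-∀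
  p∣p^d : p ∣ p ^ d
  p∣p^d rewrite sym (suc-pred d {{>-nonZero (m<n⇒0<n∸m νa<νb)}}) = m∣m*n (p ^ pred d)
  p∤sum : p ∤ m + p ^ d * m′
  p∤sum p∣sum = p∤m (∣m+n∣m⇒∣n (subst (p ∣_) (+-comm m _) p∣sum) (∣m⇒∣m*n m′ p∣p^d))

ν-+ : 1 < p → ∀ a b → .{{NonZero a}} → .{{NonZero b}} → ν p a ≢ ν p b → ν p (a + b) ≡ ν p a ⊓ ν p b
ν-+ {p} 1<p a b νa≢νb with <-cmp (ν p a) (ν p b)
... | tri< νa<νb _ _ = trans (ν-+-< 1<p a b νa<νb) (sym (m≤n⇒m⊓n≡m (<⇒≤ νa<νb)))
... | tri≈ _ νa≡νb _ = contradiction νa≡νb νa≢νb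
... | tri> _ _ νb<νa = begin
  ν p (a + b)        ≡⟨ cong (ν p) (+-comm a b) ⟩
  ν p (b + a)        ≡⟨ ν-+-< 1<p b a νb<νa ⟩
  ν p b              ≡⟨ m≥n⇒m⊓n≡n (<⇒≤ νb<νa) ⟨
  ν p a ⊓ ν p b      ∎
  where open ≡-Reasoning

ν≡0 : 1 < p → ∀ n → .{{NonZero n}} → p ∤ n → ν p n ≡ 0
ν≡0 1<p n = ν-unique 1<p (sym (*-identityˡ n))

ν>0 : 1 < p → ∀ n → .{{NonZero n}} → p ∣ n → 0 < ν p n
ν>0 {p} 1<p n p∣n with ν p n | ν-decomposition 1<p n
... | zero  | m , n≡m , p∤m = contradiction (subst (p ∣_) (trans n≡m (*-identityˡ m)) p∣n) p∤m
... | suc _ | _ = s≤s z≤n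

ν<self : 1 < p → ∀ n → .{{NonZero n}} → ν p n < n
ν<self {p} 1<p n with ν-decomposition 1<p n
... | m , n≡ , _ = <-≤-trans (n<p^n (ν p n)) (∣⇒≤ (divides m (trans n≡ (*-comm (p ^ ν p n) m))))
  where
  n<p^n : ∀ e → e < p ^ e
  n<p^n zero = s≤s z≤n
  n<p^n (suc e) = <-≤-trans (s≤s (n<p^n e)) (^-monoʳ-< p 1<p (n<1+n e))

>1⇒∤1 : 1 < p → p ∤ 1
>1⇒∤1 1<p p∣1 = <⇒≢ 1<p (sym (∣1⇒≡1 p∣1))

ν-self : 1 < p → ν p p ≡ 1
ν-self {p@(suc _)} 1<p = ν-unique 1<p (sym (trans (*-identityʳ (p * 1)) (*-identityʳ p))) (>1⇒∤1 1<p)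

ν-^ : Prime p → ∀ q → .{{NonZero q}} → ∀ e → ν p (q ^ e) ≡ e * ν p q
ν-^ p-prime q zero = ν≡0 (prime⇒>1 p-prime) 1 (>1⇒∤1 (prime⇒>1 p-prime))
ν-^ {p} p-prime q (suc e) = trans (ν-* p-prime q (q ^ e)) (cong (ν p q +_) (ν-^ p-prime q e))
  where
  instance
    q^e≢0 : NonZero (q ^ e)
    q^e≢0 = m^n≢0 q e

prime-divisor : ∀ n → .{{NonZero n}} → 1 < n → ∃[ p ] Prime p × p ∣ n
prime-divisor n 1<n with factorise n
... | record { factors = [] ; isFactorisation = n≡1 } = contradiction n≡1 (>⇒≢ 1<n)
... | record { factors = p ∷ ps ; isFactorisation = n≡ ; factorsPrime = p-prime ∷ _ } =
  p , p-prime , subst (p ∣_) (sym n≡) (m∣m*n (product ps))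

∤⇒ν> : ∀ x y → .{{NonZero x}} → .{{NonZero y}} → x ∤ y → ∃[ p ] Prime p × ν p y < ν p x
∤⇒ν> = <-rec (λ x → ∀ y → .{{NonZero x}} → .{{NonZero y}} → x ∤ y → ∃[ p ] Prime p × ν p y < ν p x) step
  where
  step : ∀ x → (∀ {x′} → x′ < x → ∀ y → .{{NonZero x′}} → .{{NonZero y}} → x′ ∤ y → ∃[ p ] Prime p × ν p y < ν p x′) →
         ∀ y → .{{NonZero x}} → .{{NonZero y}} → x ∤ y → ∃[ p ] Prime p × ν p y < ν p x
  step 1 _ y x∤y = contradiction (1∣ y) x∤y
  step x@(2+ _) rec y x∤y with prime-divisor x (s≤s (s≤s z≤n))
  ... | p , p-prime , p∣x with p ∣? y
  ...   | no p∤y = p , p-prime , subst (_< ν p x) (sym (ν≡0 1<p y p∤y)) (ν>0 1<p x p∣x)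
    where
    1<p : 1 < p
    1<p = prime⇒>1 p-prime
  step x rec y x∤y | p , p-prime , divides qx@(suc _) x≡qx*p | yes (divides qy@(suc _) y≡qy*p)
    with rec qx<x qy qx∤qy
    where
    qx<x : qx < x
    qx<x = subst (qx <_) (sym x≡qx*p) (m<m*n qx p (prime⇒>1 p-prime))
    qx∤qy : qx ∤ qy
    qx∤qy qx∣qy = x∤y (subst₂ _∣_ (sym x≡qx*p) (sym y≡qy*p) (*-monoˡ-∣ p qx∣qy))
  ... | p′ , prime′ , ν<ν = p′ , prime′ , subst₂ _<_ (sym νy) (sym νx) (+-monoˡ-< (ν p′ p) ν<ν)
    where
    instance
      p≢0 : NonZero p
      p≢0 = prime⇒nonZero p-prime
    νx : ν p′ x ≡ ν p′ qx + ν p′ p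
    νx = trans (cong (ν p′) x≡qx*p) (ν-* prime′ qx p)
    νy : ν p′ y ≡ ν p′ qy + ν p′ p
    νy = trans (cong (ν p′) y≡qy*p) (ν-* prime′ qy p)
  step x rec y x∤y | _ , _ , divides zero x≡0 | _ = contradiction x≡0 (≢-nonZero⁻¹ x)
  step x rec y x∤y | _ , _ , _ | yes (divides zero y≡0) = contradiction y≡0 (≢-nonZero⁻¹ y)

≢⇒ν≢ : ∀ x y → .{{NonZero x}} → .{{NonZero y}} → x ≢ y → ∃[ p ] Prime p × ν p x ≢ ν p y
≢⇒ν≢ x y x≢y with x ∣? y | y ∣? x
... | yes x∣y | yes y∣x = contradiction (∣-antisym x∣y y∣x) x≢y
... | no x∤y | _ with ∤⇒ν> x y x∤y
...   | p , p-prime , νy<νx = p , p-prime , ≢-sym (<⇒≢ νy<νx)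
≢⇒ν≢ x y x≢y | _ | no y∤x with ∤⇒ν> y x y∤x
...   | p , p-prime , νx<νy = p , p-prime , <⇒≢ νx<νy

ν-injective : ∀ x y → .{{NonZero x}} → .{{NonZero y}} → (∀ p → Prime p → ν p x ≡ ν p y) → x ≡ y
ν-injective x y νx≡νy with x ≟ y
... | yes x≡y = x≡y
... | no x≢y with ≢⇒ν≢ x y x≢y
...   | p , p-prime , νx≢νy = contradiction (νx≡νy p p-prime) νx≢νy

ν[2]≡0 : Prime p → p ≢ 2 → ν p 2 ≡ 0
ν[2]≡0 {p} p-prime p≢2 = ν≡0 (prime⇒>1 p-prime) 2 λ p∣2 → p≢2 (≤-antisym (∣⇒≤ p∣2) (prime⇒>1 p-prime))

ν-*2^ : Prime p → p ≢ 2 → ∀ c → .{{NonZero c}} → ∀ j → ν p (c * 2 ^ j) ≡ ν p c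
ν-*2^ {p} p-prime p≢2 c j = begin
  ν p (c * 2 ^ j)       ≡⟨ ν-* p-prime c (2 ^ j) ⟩
  ν p c + ν p (2 ^ j)   ≡⟨ cong (ν p c +_) (trans (ν-^ p-prime 2 j) (cong (j *_) (ν[2]≡0 p-prime p≢2))) ⟩
  ν p c + j * 0         ≡⟨ cong (ν p c +_) (*-zeroʳ j) ⟩
  ν p c + 0             ≡⟨ +-identityʳ (ν p c) ⟩
  ν p c                 ∎
  where
  open ≡-Reasoning
  instance
    2^j≢0 : NonZero (2 ^ j)
    2^j≢0 = m^n≢0 2 j

ν₂-*2^ : ∀ c → .{{NonZero c}} → ∀ j → ν 2 (c * 2 ^ j) ≡ ν 2 c + j
ν₂-*2^ c j = begin
  ν 2 (c * 2 ^ j)       ≡⟨ ν-* prime[2] c (2 ^ j) ⟩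
  ν 2 c + ν 2 (2 ^ j)   ≡⟨ cong (ν 2 c +_) (trans (ν-^ prime[2] 2 j) (cong (j *_) (ν-self {2} (s≤s (s≤s z≤n))))) ⟩
  ν 2 c + j * 1         ≡⟨ cong (ν 2 c +_) (*-identityʳ j) ⟩
  ν 2 c + j             ∎
  where
  open ≡-Reasoning
  instance
    2^j≢0 : NonZero (2 ^ j)
    2^j≢0 = m^n≢0 2 j

-- An additive code of the prime factorisation

evalDigits : ℕ → (ℕ → ℕ) → ℕ → ℕ
evalDigits N d zero = 0
evalDigits N d (suc i) = evalDigits N d i + d i * N ^ i

evalDigits-+ : ∀ N d d′ d″ i → (∀ j → d j ≡ d′ j + d″ j) → evalDigits N d i ≡ evalDigits N d′ i + evalDigits N d″ i
evalDigits-+ N d d′ d″ zero _ = refl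
evalDigits-+ N d d′ d″ (suc i) d≡d′+d″ = begin
  evalDigits N d i + d i * N ^ i
    ≡⟨ cong₂ (λ s x → s + x * N ^ i) (evalDigits-+ N d d′ d″ i d≡d′+d″) (d≡d′+d″ i) ⟩
  evalDigits N d′ i + evalDigits N d″ i + (d′ i + d″ i) * N ^ i
    ≡⟨ interchange (evalDigits N d′ i) (evalDigits N d″ i) (d′ i) (d″ i) (N ^ i) ⟩
  evalDigits N d′ i + d′ i * N ^ i + (evalDigits N d″ i + d″ i * N ^ i) ∎
  where
  open ≡-Reasoning
  interchange : ∀ a b x y z → a + b + (x + y) * z ≡ a + x * z + (b + y * z)
  interchange = solve-∀

evalDigits-< : ∀ N d i → (∀ j → d j < N) → evalDigits N d i < N ^ i
evalDigits-< N d zero _ = s≤s z≤n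
evalDigits-< N d (suc i) d<N = begin-strict
  evalDigits N d i + d i * N ^ i   <⟨ +-monoˡ-< (d i * N ^ i) (evalDigits-< N d i d<N) ⟩
  N ^ i + d i * N ^ i              ≡⟨⟩
  suc (d i) * N ^ i                ≤⟨ *-monoˡ-≤ (N ^ i) (d<N i) ⟩
  N * N ^ i                        ∎
  where open ≤-Reasoning

+-*-< : ∀ {N s t x y} → s < N → x < y → s + x * N < t + y * N
+-*-< {N} {s} {t} {x} {y} s<N x<y = begin-strict
  s + x * N   <⟨ +-monoˡ-< (x * N) s<N ⟩
  suc x * N   ≤⟨ *-monoˡ-≤ N x<y ⟩
  y * N       ≤⟨ m≤n+m (y * N) t ⟩
  t + y * N   ∎
  where open ≤-Reasoning

+-*-injective : ∀ {N s t x y} → s < N → t < N → s + x * N ≡ t + y * N → x ≡ y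
+-*-injective s<N t<N eq with <-cmp _ _
... | tri≈ _ x≡y _ = x≡y
... | tri< x<y _ _ = contradiction eq (<⇒≢ (+-*-< s<N x<y))
... | tri> _ _ y<x = contradiction eq (≢-sym (<⇒≢ (+-*-< t<N y<x)))

evalDigits-injective : ∀ N d d′ i → (∀ j → d j < N) → (∀ j → d′ j < N) →
                       evalDigits N d i ≡ evalDigits N d′ i → ∀ j → j < i → d j ≡ d′ j
evalDigits-injective N d d′ (suc i) d<N d′<N eq = digits
  where
  top-digit : d i ≡ d′ i
  top-digit = +-*-injective (evalDigits-< N d i d<N) (evalDigits-< N d′ i d′<N) eq
  lower-digits : evalDigits N d i ≡ evalDigits N d′ i
  lower-digits = +-cancelʳ-≡ (d i * N ^ i) _ _ (trans eq (cong (λ x → evalDigits N d′ i + x * N ^ i) (sym top-digit)))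
  digits : ∀ j → j < suc i → d j ≡ d′ j
  digits j j<1+i with m≤n⇒m<n∨m≡n (≤-pred j<1+i)
  ... | inj₂ refl = top-digit
  ... | inj₁ j<i = evalDigits-injective N d d′ i d<N d′<N lower-digits j j<i

primeExponent : ℕ → ℕ → ℕ
primeExponent n j with prime? j
... | yes _ = ν j n
... | no _ = 0

-- In base B + 1, the j-th digit of expCode B n is the exponent of j in n if j is prime;
-- for 0 < n ≤ B all digits are ≤ B, and primes above B do not divide n.
expCode : ℕ → ℕ → ℕ
expCode B n = evalDigits (suc B) (primeExponent n) (suc B)

expCode-* : ∀ B a b → .{{NonZero a}} → .{{NonZero b}} → expCode B (a * b) ≡ expCode B a + expCode B b
expCode-* B a b = evalDigits-+ (suc B) (primeExponent (a * b)) (primeExponent a) (primeExponent b) (suc B) digit-*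
  where
  digit-* : ∀ j → primeExponent (a * b) j ≡ primeExponent a j + primeExponent b j
  digit-* j with prime? j
  ... | yes j-prime = ν-* j-prime a b
  ... | no _ = refl

expCode-injective : ∀ B a b → .{{NonZero a}} → .{{NonZero b}} → a ≤ B → b ≤ B → expCode B a ≡ expCode B b → a ≡ b
expCode-injective B a b a≤B b≤B code≡ = ν-injective a b same-ν
  where
  digit-< : ∀ n → .{{NonZero n}} → n ≤ B → ∀ j → primeExponent n j < suc B
  digit-< n n≤B j with prime? j
  ... | yes j-prime = ≤-trans (ν<self (prime⇒>1 j-prime) n) (m≤n⇒m≤1+n n≤B)
  ... | no _ = s≤s z≤n
  same-digit : ∀ j → j < suc B → primeExponent a j ≡ primeExponent b j
  same-digit = evalDigits-injective (suc B) _ _ (suc B) (digit-< a a≤B) (digit-< b b≤B) code≡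
  same-ν : ∀ p → Prime p → ν p a ≡ ν p b
  same-ν p p-prime with p <? suc B
  ... | yes p≤B with same-digit p p≤B
  ...   | same with prime? p
  ...     | yes _ = same
  ...     | no ¬prime = contradiction p-prime ¬prime
  same-ν p p-prime | no p>B = trans (ν≡0 1<p a (too-big a≤B)) (sym (ν≡0 1<p b (too-big b≤B)))
    where
    1<p : 1 < p
    1<p = prime⇒>1 p-prime
    too-big : ∀ {n} → .{{NonZero n}} → n ≤ B → p ∤ n
    too-big n≤B p∣n = p>B (s≤s (≤-trans (∣⇒≤ p∣n) n≤B))

-- Freiman's lemma: a non-collinear set of k points has at least 3k − 3 sums

module Freiman (F : ℕ → ℕ) (F-* : ∀ a b → .{{NonZero a}} → .{{NonZero b}} → F (a * b) ≡ F a + F b) where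

  record Faithful (B : List ℕ) : Set where
    field
      unique : Unique B
      nonZero : ∀ {a} → a ∈ B → NonZero a
      injective : ∀ {a b} → a ∈ B → b ∈ B → F a ≡ F b → a ≡ b

  faithful-⊆ : ∀ {B B′} → Unique B′ → B′ ⊆ B → Faithful B → Faithful B′
  faithful-⊆ B′! B′⊆B faithful = record
    { unique = B′!
    ; nonZero = nonZero ∘ B′⊆B
    ; injective = λ a∈ b∈ → injective (B′⊆B a∈) (B′⊆B b∈) }
    where open Faithful faithful

  F-<⇒*-≢ : ∀ {u w x y} → .{{NonZero u}} → .{{NonZero w}} → .{{NonZero x}} → .{{NonZero y}} →
             F x + F y < F u + F w → u * w ≢ x * y
  F-<⇒*-≢ {u} {w} {x} {y} F<F uw≡xy = <⇒≢ F<F (begin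
    F x + F y   ≡⟨ F-* x y ⟨
    F (x * y)   ≡⟨ cong F uw≡xy ⟨
    F (u * w)   ≡⟨ F-* u w ⟩
    F u + F w   ∎)
    where open ≡-Reasoning

  record Peeled (B : List ℕ) : Set where
    field
      top : ℕ
      top∈ : top ∈ B
      removal : Removal top B
      below : ∀ {z} → z ∈ Removal.rest removal → F z < F top

  peel : ∀ {B} → 0 < length B → Faithful B → Peeled B
  peel {B} B≢[] faithful with maximum (λ a b → F a ≤ F b) B B≢[] (λ {a} {b} _ _ → ≤-total (F a) (F b)) (λ _ _ _ → ≤-trans)
  ... | v , v∈ , F≤F-v = record { top = v ; top∈ = v∈ ; removal = removal ; below = below }
    where
    open Faithful faithful
    removal : Removal v B
    removal = remove unique v∈
    open Removal removal
    below : ∀ {z} → z ∈ rest → F z < F v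
    below z∈ = ≤∧≢⇒< (F≤F-v (rest⊆ z∈)) λ Fz≡Fv → x∉rest (subst (_∈ rest) (injective (rest⊆ z∈) v∈ Fz≡Fv) z∈)

  module Peeling {B} (faithful : Faithful B) (peeled : Peeled B) where
    open Faithful faithful public
    open Peeled peeled public
    open Removal removal public

    nz-top : NonZero top
    nz-top = nonZero top∈

    nz-rest : ∀ {x} → x ∈ rest → NonZero x
    nz-rest = nonZero ∘ rest⊆

    faithful-rest : Faithful rest
    faithful-rest = faithful-⊆ rest-unique rest⊆ faithful

    top²∉ : ∀ {x y} → x ∈ rest → y ∈ rest → top * top ≢ x * y
    top²∉ x∈ y∈ = F-<⇒*-≢ {{nz-top}} {{nz-top}} {{nz-rest x∈}} {{nz-rest y∈}} (+-mono-< (below x∈) (below y∈))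

    top∙≢top∙ : ∀ {x y} → x ∈ rest → y ∈ rest → x ≢ y → top * x ≢ top * y
    top∙≢top∙ _ _ x≢y eq = x≢y (*-cancelˡ-≡ _ _ top {{nz-top}} eq)

    top∙≢top² : ∀ {x} → x ∈ rest → top * top ≢ top * x
    top∙≢top² x∈ eq = x∉rest (subst (_∈ rest) (sym (*-cancelˡ-≡ _ _ top {{nz-top}} eq)) x∈)

  card*≥2k∸1 : ∀ k B → length B ≡ k → Faithful B → 2 * k ≤ card* B + 1
  card*≥2k∸1 zero _ _ _ = z≤n
  card*≥2k∸1 (suc zero) B len faithful =
    +-monoˡ-≤ 1 (card*-extend {[]} {B} (λ ()) ([] ∷ []) (λ { (here refl) → ∈-prodset⁺ top∈ top∈ }) λ _ ())
    where open Peeling faithful (peel (subst (0 <_) (sym len) (s≤s z≤n)) faithful)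
  card*≥2k∸1 (suc (suc j)) B len faithful = card*-two-more j B len faithful (card*≥2k∸1 (suc j))
    where
    card*-two-more : ∀ j B → length B ≡ suc (suc j) → Faithful B →
                     (∀ B′ → length B′ ≡ suc j → Faithful B′ → 2 * suc j ≤ card* B′ + 1) →
                     2 * suc (suc j) ≤ card* B + 1
    card*-two-more j B len faithful ih =
      step (maximum (λ a b → F a ≤ F b) rest (subst (0 <_) (sym length-rest) (s≤s z≤n))
                    (λ {a} {b} _ _ → ≤-total (F a) (F b)) (λ _ _ _ → ≤-trans))
      where
      open Peeling faithful (peel (subst (0 <_) (sym len) (s≤s z≤n)) faithful)
      length-rest : length rest ≡ suc j
      length-rest = suc-injective (trans (sym length≡) len)
      step : (∃[ v′ ] v′ ∈ rest × (∀ {z} → z ∈ rest → F z ≤ F v′)) → 2 * suc (suc j) ≤ card* B + 1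
      step (v′ , v′∈ , F≤F-v′) = begin
        2 * suc (suc j)                ≡⟨ *-suc 2 (suc j) ⟩
        2 + 2 * suc j                  ≤⟨ +-monoʳ-≤ 2 (ih rest length-rest faithful-rest) ⟩
        2 + (card* rest + 1)           ≡⟨ rearrange (card* rest) ⟩
        card* rest + 2 + 1             ≤⟨ +-monoˡ-≤ 1 new ⟩
        card* B + 1                    ∎
        where
        open ≤-Reasoning
        rearrange : ∀ c → 2 + (c + 1) ≡ c + 2 + 1
        rearrange = solve-∀
        top∙v′∉ : ∀ {x y} → x ∈ rest → y ∈ rest → top * v′ ≢ x * y
        top∙v′∉ x∈ y∈ = F-<⇒*-≢ {{nz-top}} {{nz-rest v′∈}} {{nz-rest x∈}} {{nz-rest y∈}} (+-mono-<-≤ (below x∈) (F≤F-v′ y∈))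
        E⊆BB : top * top ∷ top * v′ ∷ [] ⊆ prodset B
        E⊆BB (here refl) = ∈-prodset⁺ top∈ top∈
        E⊆BB (there (here refl)) = ∈-prodset⁺ top∈ (rest⊆ v′∈)
        E∉ : ∀ {e x y} → e ∈ top * top ∷ top * v′ ∷ [] → x ∈ rest → y ∈ rest → e ≢ x * y
        E∉ (here refl) = top²∉
        E∉ (there (here refl)) = top∙v′∉
        new : card* rest + 2 ≤ card* B
        new = card*-extend rest⊆ ((top∙≢top² v′∈ ∷ []) ∷ [] ∷ []) E⊆BB E∉

  IsHom : (ℕ → ℤ) → Set
  IsHom G = ∀ a b → .{{NonZero a}} → .{{NonZero b}} → G (a * b) ≡ G a ℤ.+ G b

  point : (ℕ → ℤ) → ℕ → Point
  point G n = (ℤ.+ F n , G n)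

  point-* : ∀ G → IsHom G → ∀ a b → .{{NonZero a}} → .{{NonZero b}} → point G (a * b) ≡ point G a ⊕ point G b
  point-* G G-* a b = cong₂ _,_ (trans (cong ℤ.+_ (F-* a b)) (ℤ.pos-+ (F a) (F b))) (G-* a b)

  Collinear : (ℕ → ℤ) → List ℕ → Set
  Collinear G B = ∀ {x y z} → x ∈ B → y ∈ B → z ∈ B → orient (point G x) (point G y) (point G z) ≡ 0ℤ

  record NonCollinear (G : ℕ → ℤ) (B : List ℕ) : Set where
    constructor nonCollinear
    field
      {x y z} : ℕ
      x∈ : x ∈ B
      y∈ : y ∈ B
      z∈ : z ∈ B
      orient≢0 : orient (point G x) (point G y) (point G z) ≢ 0ℤ

  collinear-or-not : ∀ G B → Collinear G B ⊎ NonCollinear G B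
  collinear-or-not G B with any? (λ x → any? (λ y → any? (λ z → ¬? (orient (point G x) (point G y) (point G z) ℤ.≟ 0ℤ)) B) B) B
  ... | yes any-x with find any-x
  ...   | x , x∈ , any-y with find any-y
  ...   | y , y∈ , any-z with find any-z
  ...   | z , z∈ , orient≢0 = inj₂ (nonCollinear x∈ y∈ z∈ orient≢0)
  collinear-or-not G B | no none = inj₁ collinear
    where
    collinear : Collinear G B
    collinear {x} {y} {z} x∈ y∈ z∈ with orient (point G x) (point G y) (point G z) ℤ.≟ 0ℤ
    ... | yes orient≡0 = orient≡0
    ... | no orient≢0 = contradiction (lose x∈ (lose y∈ (lose z∈ orient≢0))) none

  collinear-on-line : ∀ {G B o a} → F o ≢ F a →
                      (∀ {p} → p ∈ B → orient (point G o) (point G a) (point G p) ≡ 0ℤ) → Collinear G B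
  collinear-on-line {G} {o = o} {a} Fo≢Fa on-line {x} {y} {z} x∈ y∈ z∈ =
    orient-on-line {point G o} {point G a} {point G x} {point G y} {point G z}
                   (Fo≢Fa ∘ ℤ.+-injective) (on-line x∈) (on-line y∈) (on-line z∈)

  module Extreme (G : ℕ → ℤ) (G-* : IsHom G) {B} (faithful : Faithful B) (peeled : Peeled B) where
    open Peeling faithful peeled

    κ : ℕ → ℕ → ℤ
    κ z m = orient (point G top) (point G m) (point G z)

    -- Seen from top, z lies weakly clockwise of m, ties on a ray broken by F.  As rest lies
    -- strictly to the left of top, this is a total preorder on rest.
    _≼_ : ℕ → ℕ → Set
    z ≼ m = 0ℤ ℤ.< κ z m ⊎ (κ z m ≡ 0ℤ × F z ≤ F m)

    ≼⇒0≤κ : ∀ {z m} → z ≼ m → 0ℤ ℤ.≤ κ z m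
    ≼⇒0≤κ (inj₁ 0<κ) = ℤ.<⇒≤ 0<κ
    ≼⇒0≤κ (inj₂ (κ≡0 , _)) = ℤ.≤-reflexive (sym κ≡0)

    ≼∧κ≡0⇒F≤ : ∀ {z m} → z ≼ m → κ z m ≡ 0ℤ → F z ≤ F m
    ≼∧κ≡0⇒F≤ (inj₁ 0<κ) κ≡0 = contradiction (subst (0ℤ ℤ.<_) κ≡0 0<κ) (ℤ.<-irrefl refl)
    ≼∧κ≡0⇒F≤ (inj₂ (_ , F≤)) _ = F≤

    ≼-total : ∀ z m → z ≼ m ⊎ m ≼ z
    ≼-total z m with ℤ.<-cmp (κ z m) 0ℤ | orient-antisym (point G top) (point G z) (point G m)
    ... | tri> _ _ 0<κ | _ = inj₁ (inj₁ 0<κ)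
    ... | tri< κ<0 _ _ | κmz≡-κzm = inj₂ (inj₁ (subst (0ℤ ℤ.<_) (sym κmz≡-κzm) (ℤ.neg-mono-< κ<0)))
    ... | tri≈ _ κ≡0 _ | κmz≡-κzm with F z ≤? F m
    ...   | yes F≤ = inj₁ (inj₂ (κ≡0 , F≤))
    ...   | no F≰ = inj₂ (inj₂ (trans κmz≡-κzm (cong ℤ.-_ κ≡0) , ≰⇒≥ F≰))

    ≼-trans : ∀ {x y z} → x ∈ rest → y ∈ rest → z ∈ rest → x ≼ y → y ≼ z → x ≼ z
    ≼-trans {x} {y} {z} x∈ y∈ z∈ x≼y y≼z = combine x≼y y≼z
      where
      Δ : ℕ → ℤ
      Δ w = ℤ.+ F top ℤ.- ℤ.+ F w
      Δ>0 : ∀ {w} → w ∈ rest → 0ℤ ℤ.< Δ w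
      Δ>0 {w} w∈ = subst (0ℤ ℤ.<_) (sym (trans (ℤ.m-n≡m⊖n (F top) (F w)) (ℤ.⊖-≥ (<⇒≤ (below w∈)))))
                         (ℤ.+<+ (m<n⇒0<n∸m (below w∈)))
      cyclic : κ x y ℤ.* Δ z ℤ.+ κ y z ℤ.* Δ x ≡ κ x z ℤ.* Δ y
      cyclic = orient-cyclic (point G top) (point G x) (point G y) (point G z)
      positive : 0ℤ ℤ.< κ x y ℤ.* Δ z ℤ.+ κ y z ℤ.* Δ x → x ≼ z
      positive 0<lhs = inj₁ (*-pos⁻¹ (Δ>0 y∈) (subst (0ℤ ℤ.<_) cyclic 0<lhs))
      combine : x ≼ y → y ≼ z → x ≼ z
      combine (inj₁ 0<κxy) y≼z = positive (ℤ.+-mono-<-≤ (*-pos 0<κxy (Δ>0 z∈)) (*-nonNeg (≼⇒0≤κ y≼z) (Δ>0 x∈)))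
      combine x≼y@(inj₂ _) (inj₁ 0<κyz) = positive (ℤ.+-mono-≤-< (*-nonNeg (≼⇒0≤κ x≼y) (Δ>0 z∈)) (*-pos 0<κyz (Δ>0 x∈)))
      combine (inj₂ (κxy≡0 , Fx≤Fy)) (inj₂ (κyz≡0 , Fy≤Fz)) = inj₂ (*-zero⁻¹ (Δ>0 y∈) (begin
        κ x z ℤ.* Δ y                          ≡⟨ cyclic ⟨
        κ x y ℤ.* Δ z ℤ.+ κ y z ℤ.* Δ x        ≡⟨ cong₂ (λ a b → a ℤ.* Δ z ℤ.+ b ℤ.* Δ x) κxy≡0 κyz≡0 ⟩
        0ℤ                                     ∎) , ≤-trans Fx≤Fy Fy≤Fz)
        where open ≡-Reasoning

    IsExtreme : ℕ → Set
    IsExtreme u = u ∈ rest × (∀ {z} → z ∈ rest → z ≼ u) × (∀ {x y} → x ∈ rest → y ∈ rest → top * u ≢ x * y)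

    extreme : 0 < length rest → ∃[ u ] IsExtreme u
    extreme rest≢[] with maximum _≼_ rest rest≢[] (λ {z} {m} _ _ → ≼-total z m) ≼-trans
    ... | u , u∈ , z≼u = u , u∈ , z≼u , top∙u∉
      where
      top∙u∉ : ∀ {x y} → x ∈ rest → y ∈ rest → top * u ≢ x * y
      top∙u∉ {x} {y} x∈ y∈ top∙u≡xy =
        F-<⇒*-≢ {{nz-top}} {{nz-rest u∈}} {{nz-rest x∈}} {{nz-rest y∈}}
                 (+-mono-<-≤ (below x∈) (≼∧κ≡0⇒F≤ (z≼u y∈) κyu≡0)) top∙u≡xy
        where
        κ-sum : κ x u ℤ.+ κ y u ≡ 0ℤ
        κ-sum = trans (orient-split (point G top) (point G u) (point G x) (point G y) (point G u) sums≡)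
                      (orient-degenerate (point G top) (point G u))
          where
          sums≡ : point G top ⊕ point G u ≡ point G x ⊕ point G y
          sums≡ = trans (sym (point-* G G-* top u {{nz-top}} {{nz-rest u∈}}))
                        (trans (cong (point G) top∙u≡xy) (point-* G G-* x y {{nz-rest x∈}} {{nz-rest y∈}}))
        κyu≡0 : κ y u ≡ 0ℤ
        κyu≡0 = nonNeg-+-≡0 (≼⇒0≤κ (z≼u y∈)) (≼⇒0≤κ (z≼u x∈)) (trans (ℤ.+-comm (κ y u) (κ x u)) κ-sum)

  negate-hom : ∀ {G} → IsHom G → IsHom (λ n → ℤ.- G n)
  negate-hom {G} G-* a b = trans (cong ℤ.-_ (G-* a b)) (ℤ.neg-distrib-+ (G a) (G b))

  module Growth (G : ℕ → ℤ) (G-* : IsHom G) {B} (faithful : Faithful B) (peeled : Peeled B) where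
    open Peeling faithful peeled
    module Up = Extreme G G-* faithful peeled
    -- Reflection reverses orientation, so the extreme point for Down is the clockwise one.
    module Down = Extreme (λ n → ℤ.- G n) (negate-hom {G} G-*) faithful peeled

    extremes-differ : NonCollinear G rest → ∀ {u w} → u ∈ rest →
                      (∀ {p} → p ∈ rest → p Up.≼ u) → (∀ {p} → p ∈ rest → p Down.≼ w) → u ≢ w
    extremes-differ nc {u} u∈ ≼↑u ≼↓u refl = orient≢0 (collinear-on-line {G} {o = top} {u} (<⇒≢ (below u∈) ∘ sym) on-line x∈ y∈ z∈)
      where
      open NonCollinear nc
      on-line : ∀ {p} → p ∈ rest → orient (point G top) (point G u) (point G p) ≡ 0ℤ
      on-line {p} p∈ = nonNeg-+-≡0 (Up.≼⇒0≤κ (≼↑u p∈)) 0≤-κ (ℤ.+-inverseʳ (Up.κ p u))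
        where
        0≤-κ : 0ℤ ℤ.≤ ℤ.- Up.κ p u
        0≤-κ = subst (0ℤ ℤ.≤_) (orient-reflect (point G top) (point G u) (point G p)) (Down.≼⇒0≤κ (≼↓u p∈))

    card*-+3 : NonCollinear G rest → card* rest + 3 ≤ card* B
    card*-+3 nc = add (Up.extreme rest≢[]) (Down.extreme rest≢[])
      where
      rest≢[] : 0 < length rest
      rest≢[] = ∈-length (NonCollinear.x∈ nc)
      add : ∃ Up.IsExtreme → ∃ Down.IsExtreme → card* rest + 3 ≤ card* B
      add (u , u∈ , ≼↑u , top∙u∉) (w , w∈ , ≼↓w , top∙w∉) = card*-extend rest⊆ E-unique E⊆BB E∉
        where
        E : List ℕ
        E = top * top ∷ top * u ∷ top * w ∷ []
        E-unique : Unique E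
        E-unique = (top∙≢top² u∈ ∷ top∙≢top² w∈ ∷ []) ∷ (top∙≢top∙ u∈ w∈ (extremes-differ nc u∈ ≼↑u ≼↓w) ∷ []) ∷ [] ∷ []
        E⊆BB : E ⊆ prodset B
        E⊆BB (here refl) = ∈-prodset⁺ top∈ top∈
        E⊆BB (there (here refl)) = ∈-prodset⁺ top∈ (rest⊆ u∈)
        E⊆BB (there (there (here refl))) = ∈-prodset⁺ top∈ (rest⊆ w∈)
        E∉ : ∀ {e x y} → e ∈ E → x ∈ rest → y ∈ rest → e ≢ x * y
        E∉ (here refl) = top²∉
        E∉ (there (here refl)) = top∙u∉
        E∉ (there (there (here refl))) = top∙w∉

    -- top·x = y·z means point top ⊕ point x = point y ⊕ point z, so top lies on the line of rest.
    collinear-through-top : Collinear G rest → ∀ {x y z} → x ∈ rest → y ∈ rest → z ∈ rest → top * x ≡ y * z →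
                            ∀ {a p} → a ∈ rest → p ∈ B → orient (point G x) (point G a) (point G p) ≡ 0ℤ
    collinear-through-top collinear {x} {y} {z} x∈ y∈ z∈ top∙x≡yz {a} a∈ p∈ with ⊆x∷rest p∈
    ... | there p∈rest = collinear x∈ a∈ p∈rest
    ... | here refl = begin
      orient (point G x) (point G a) (point G top)
        ≡⟨ orient-split (point G x) (point G a) (point G y) (point G z) (point G top) sums≡ ⟨
      orient (point G x) (point G a) (point G y) ℤ.+ orient (point G x) (point G a) (point G z)
        ≡⟨ cong₂ ℤ._+_ (collinear x∈ a∈ y∈) (collinear x∈ a∈ z∈) ⟩
      0ℤ ∎
      where
      open ≡-Reasoning
      sums≡ : point G x ⊕ point G top ≡ point G y ⊕ point G z
      sums≡ = begin
        point G x ⊕ point G top   ≡⟨ point-* G G-* x top {{nz-rest x∈}} {{nz-top}} ⟨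
        point G (x * top)         ≡⟨ cong (point G) (trans (*-comm x top) top∙x≡yz) ⟩
        point G (y * z)           ≡⟨ point-* G G-* y z {{nz-rest y∈}} {{nz-rest z∈}} ⟩
        point G y ⊕ point G z     ∎

    top∙≡-off-line : Collinear G rest → NonCollinear G B → ∀ {x y z a} → x ∈ rest → y ∈ rest → z ∈ rest →
                     top * x ≡ y * z → a ∈ rest → a ≢ x → ⊥
    top∙≡-off-line collinear nc {x} {a = a} x∈ y∈ z∈ top∙x≡yz a∈ a≢x =
      orient≢0 (collinear-on-line {G} {o = x} {a} (a≢x ∘ sym ∘ injective (rest⊆ x∈) (rest⊆ a∈))
                                  (collinear-through-top collinear x∈ y∈ z∈ top∙x≡yz a∈) x∈B y∈B z∈B)
      where open NonCollinear nc using (orient≢0) renaming (x∈ to x∈B; y∈ to y∈B; z∈ to z∈B)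

    top∙∉-line : Collinear G rest → NonCollinear G B → ∀ {x y z} → x ∈ rest → y ∈ rest → z ∈ rest → top * x ≢ y * z
    top∙∉-line collinear nc {x} {y} {z} x∈ y∈ z∈ top∙x≡yz with y ≟ x | z ≟ x
    ... | no y≢x | _ = top∙≡-off-line collinear nc x∈ y∈ z∈ top∙x≡yz y∈ y≢x
    ... | yes refl | no z≢x = top∙≡-off-line collinear nc x∈ y∈ z∈ top∙x≡yz z∈ z≢x
    ... | yes refl | yes refl = x∉rest (subst (_∈ rest) (sym (*-cancelʳ-≡ top x x {{nz-rest x∈}} top∙x≡yz)) x∈)

    card*-+line : Collinear G rest → NonCollinear G B → card* rest + suc (length rest) ≤ card* B
    card*-+line collinear nc =
      subst (λ n → card* rest + suc n ≤ card* B) (length-map (top *_) rest) (card*-extend rest⊆ E-unique E⊆BB E∉)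
      where
      E : List ℕ
      E = top * top ∷ map (top *_) rest
      E-unique : Unique E
      E-unique = All.tabulate top²≢ ∷ Unique.map⁺ (*-cancelˡ-≡ _ _ top {{nz-top}}) rest-unique
        where
        top²≢ : ∀ {e} → e ∈ map (top *_) rest → top * top ≢ e
        top²≢ e∈ with ∈-map⁻ (top *_) e∈
        ... | x , x∈ , refl = top∙≢top² x∈
      E⊆BB : E ⊆ prodset B
      E⊆BB (here refl) = ∈-prodset⁺ top∈ top∈
      E⊆BB (there e∈) with ∈-map⁻ (top *_) e∈
      ... | x , x∈ , refl = ∈-prodset⁺ top∈ (rest⊆ x∈)
      E∉ : ∀ {e x y} → e ∈ E → x ∈ rest → y ∈ rest → e ≢ x * y
      E∉ (here refl) = top²∉
      E∉ (there e∈) with ∈-map⁻ (top *_) e∈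
      ... | x , x∈ , refl = top∙∉-line collinear nc x∈

  card*≥3k∸3 : ∀ G → IsHom G → ∀ k B → length B ≡ k → Faithful B → NonCollinear G B → 3 * k ≤ card* B + 3
  card*≥3k∸3 G G-* zero _ _ _ _ = z≤n
  card*≥3k∸3 G G-* (suc k) B len faithful nc = card*-three-more k B len faithful nc (card*≥3k∸3 G G-* k)
    where
    card*-three-more : ∀ k B → length B ≡ suc k → Faithful B → NonCollinear G B →
                       (∀ B′ → length B′ ≡ k → Faithful B′ → NonCollinear G B′ → 3 * k ≤ card* B′ + 3) →
                       3 * suc k ≤ card* B + 3
    card*-three-more k B len faithful nc ih = [ via-line , via-extremes ]′ (collinear-or-not G rest)
      where
      peeled : Peeled B
      peeled = peel (subst (0 <_) (sym len) (s≤s z≤n)) faithful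
      open Peeling faithful peeled
      open Growth G G-* faithful peeled
      length-rest : length rest ≡ k
      length-rest = suc-injective (trans (sym length≡) len)
      via-extremes : NonCollinear G rest → 3 * suc k ≤ card* B + 3
      via-extremes nc-rest = begin
        3 * suc k              ≡⟨ *-suc 3 k ⟩
        3 + 3 * k              ≤⟨ +-monoʳ-≤ 3 (ih rest length-rest faithful-rest nc-rest) ⟩
        3 + (card* rest + 3)   ≡⟨ +-comm 3 (card* rest + 3) ⟩
        card* rest + 3 + 3     ≤⟨ +-monoˡ-≤ 3 (card*-+3 nc-rest) ⟩
        card* B + 3            ∎
        where open ≤-Reasoning
      via-line : Collinear G rest → 3 * suc k ≤ card* B + 3
      via-line collinear = begin
        3 * suc k                        ≡⟨ *-suc 3 k ⟩
        3 + 3 * k                        ≤⟨ +-monoʳ-≤ 3 (+-cancelʳ-≤ 1 (3 * k) (card* B) 3k+1≤) ⟩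
        3 + card* B                      ≡⟨ +-comm 3 (card* B) ⟩
        card* B + 3                      ∎
        where
        open ≤-Reasoning
        split : ∀ k → 3 * k + 1 ≡ 2 * k + suc k
        split = solve-∀
        regroup : ∀ c k → c + 1 + suc k ≡ c + suc k + 1
        regroup = solve-∀
        3k+1≤ : 3 * k + 1 ≤ card* B + 1
        3k+1≤ = begin
          3 * k + 1                      ≡⟨ split k ⟩
          2 * k + suc k                  ≤⟨ +-monoˡ-≤ (suc k) (card*≥2k∸1 k rest length-rest faithful-rest) ⟩
          card* rest + 1 + suc k         ≡⟨ regroup (card* rest) k ⟩
          card* rest + suc k + 1         ≤⟨ +-monoˡ-≤ 1 (subst (λ n → card* rest + suc n ≤ card* B) length-rest (card*-+line collinear nc)) ⟩
          card* B + 1                    ∎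

-- A collision puts A in non-collinear position for some prime

ν̂ : ℕ → ℕ → ℤ
ν̂ p n = ℤ.+ ν p n

module CollisionPrime (A : List ℕ) (A! : Unique A) (A≢0 : All NonZero A) where

  open Freiman (expCode (product A)) (expCode-* (product A)) public

  nz : ∀ {a} → a ∈ A → NonZero a
  nz = All.lookup A≢0

  faithful : Faithful A
  faithful = record
    { unique = A!
    ; nonZero = nz
    ; injective = λ {a} {b} a∈ b∈ → expCode-injective (product A) a b {{nz a∈}} {{nz b∈}} (∈⇒≤product A≢0 a∈) (∈⇒≤product A≢0 b∈) }

  ν̂-hom : ∀ {p} → Prime p → IsHom (ν̂ p)
  ν̂-hom {p} p-prime a b = trans (cong ℤ.+_ (ν-* p-prime a b)) (ℤ.pos-+ (ν p a) (ν p b))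

  -- x and y span a horizontal line, since F is injective on A; it contains every point.
  level⇒constant : ∀ {p x y} → Collinear (ν̂ p) A → x ∈ A → y ∈ A → x ≢ y → ν p x ≡ ν p y →
                   ∀ {w} → w ∈ A → ν p w ≡ ν p x
  level⇒constant {p} {x} {y} collinear x∈ y∈ x≢y νx≡νy {w} w∈ with ν p w ≟ ν p x
  ... | yes νw≡νx = νw≡νx
  ... | no νw≢νx = ⊥-elim ([ Fy≢Fx , νw≢νx ∘ ℤ.+-injective ∘ ℤ.i-j≡0⇒i≡j _ _ ]′ (ℤ.i*j≡0⇒i≡0∨j≡0 _ orient≡0))
    where
    F : ℕ → ℕ
    F = expCode (product A)
    Fy≢Fx : ℤ.+ F y ℤ.- ℤ.+ F x ≢ 0ℤ
    Fy≢Fx = x≢y ∘ sym ∘ Faithful.injective faithful y∈ x∈ ∘ ℤ.+-injective ∘ ℤ.i-j≡0⇒i≡j _ _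
    orient≡0 : (ℤ.+ F y ℤ.- ℤ.+ F x) ℤ.* (ν̂ p w ℤ.- ν̂ p x) ≡ 0ℤ
    orient≡0 = trans (sym (orient-horizontal (ℤ.+ F x) (ν̂ p x) (ℤ.+ F y) (ℤ.+ F w) (ν̂ p w)))
                     (subst (λ t → orient (point (ν̂ p) x) (ℤ.+ F y , ℤ.+ t) (point (ν̂ p) w) ≡ 0ℤ) (sym νx≡νy) (collinear x∈ y∈ w∈))

  ν-Injective : ℕ → Set
  ν-Injective p = ∀ {x y} → x ∈ A → y ∈ A → ν p x ≡ ν p y → x ≡ y

  ν-injective-on-line : ∀ p {a₁ a₂} → Collinear (ν̂ p) A → a₁ ∈ A → a₂ ∈ A → ν p a₁ ≢ ν p a₂ → ν-Injective p
  ν-injective-on-line p collinear a₁∈ a₂∈ ν₁≢ν₂ {x} {y} x∈ y∈ νx≡νy with x ≟ y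
  ... | yes x≡y = x≡y
  ... | no x≢y = contradiction (trans (constant a₁∈) (sym (constant a₂∈))) ν₁≢ν₂
    where
    constant : ∀ {w} → w ∈ A → ν p w ≡ ν p x
    constant = level⇒constant {p} collinear x∈ y∈ x≢y νx≡νy

  ν-sum≡⊓ : ∀ {p a b} → 1 < p → ν-Injective p → a ∈ A → b ∈ A → a ≢ b → ν p (a + b) ≡ ν p a ⊓ ν p b
  ν-sum≡⊓ 1<p ν-inj a∈ b∈ a≢b = ν-+ 1<p _ _ {{nz a∈}} {{nz b∈}} (a≢b ∘ ν-inj a∈ b∈)

  ν-injective⇒samePair : ∀ {p a b c d} → 1 < p → ν-Injective p → a ∈ A → b ∈ A → c ∈ A → d ∈ A →
                         a ≢ b → c ≢ d → a + b ≡ c + d → SamePair a b c d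
  ν-injective⇒samePair {p} {a} {b} {c} {d} 1<p ν-inj a∈ b∈ c∈ d∈ a≢b c≢d a+b≡c+d =
    common⇒samePair a+b≡c+d (common (⊓-sel (ν p a) (ν p b)) (⊓-sel (ν p c) (ν p d)))
    where
    ⊓≡⊓ : ν p a ⊓ ν p b ≡ ν p c ⊓ ν p d
    ⊓≡⊓ = trans (sym (ν-sum≡⊓ 1<p ν-inj a∈ b∈ a≢b)) (trans (cong (ν p) a+b≡c+d) (ν-sum≡⊓ 1<p ν-inj c∈ d∈ c≢d))
    common : ν p a ⊓ ν p b ≡ ν p a ⊎ ν p a ⊓ ν p b ≡ ν p b → ν p c ⊓ ν p d ≡ ν p c ⊎ ν p c ⊓ ν p d ≡ ν p d →
             (a ≡ c ⊎ a ≡ d) ⊎ (b ≡ c ⊎ b ≡ d)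
    common (inj₁ ⊓≡a) (inj₁ ⊓≡c) = inj₁ (inj₁ (ν-inj a∈ c∈ (trans (sym ⊓≡a) (trans ⊓≡⊓ ⊓≡c))))
    common (inj₁ ⊓≡a) (inj₂ ⊓≡d) = inj₁ (inj₂ (ν-inj a∈ d∈ (trans (sym ⊓≡a) (trans ⊓≡⊓ ⊓≡d))))
    common (inj₂ ⊓≡b) (inj₁ ⊓≡c) = inj₂ (inj₁ (ν-inj b∈ c∈ (trans (sym ⊓≡b) (trans ⊓≡⊓ ⊓≡c))))
    common (inj₂ ⊓≡b) (inj₂ ⊓≡d) = inj₂ (inj₂ (ν-inj b∈ d∈ (trans (sym ⊓≡b) (trans ⊓≡⊓ ⊓≡d))))

  NonCollinearPrime : Set
  NonCollinearPrime = ∃[ p ] Prime p × NonCollinear (ν̂ p) A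

  unless-collinear : ∀ {p} → Prime p → ¬ Collinear (ν̂ p) A → NonCollinearPrime
  unless-collinear {p} p-prime ¬collinear = decide (collinear-or-not (ν̂ p) A)
    where
    decide : Collinear (ν̂ p) A ⊎ NonCollinear (ν̂ p) A → NonCollinearPrime
    decide (inj₁ collinear) = ⊥-elim (¬collinear collinear)
    decide (inj₂ nc) = p , p-prime , nc

  distinct-collision : ∀ {a b c d} → a ∈ A → b ∈ A → c ∈ A → d ∈ A → a + b ≡ c + d → ¬ SamePair a b c d →
                       a ≢ b → c ≢ d → NonCollinearPrime
  distinct-collision {a} {b} {c} {d} a∈ b∈ c∈ d∈ a+b≡c+d ¬same a≢b c≢d =
    separating-prime (≢⇒ν≢ a c {{nz a∈}} {{nz c∈}} (¬same ∘ common⇒samePair a+b≡c+d ∘ inj₁ ∘ inj₁))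
    where
    separating-prime : (∃[ p ] Prime p × ν p a ≢ ν p c) → NonCollinearPrime
    separating-prime (p , p-prime , νa≢νc) = unless-collinear p-prime λ collinear →
      ¬same (ν-injective⇒samePair (prime⇒>1 p-prime) (ν-injective-on-line p collinear a∈ c∈ νa≢νc) a∈ b∈ c∈ d∈ a≢b c≢d a+b≡c+d)

  ν-double : ∀ {p} → Prime p → ∀ m → .{{NonZero m}} → ν p (m + m) ≡ ν p 2 + ν p m
  ν-double {p} p-prime m = trans (cong (λ n → ν p (m + n)) (sym (+-identityʳ m))) (ν-* p-prime 2 m)

  double-collision-odd : ∀ {m c d p} → m ∈ A → c ∈ A → d ∈ A → m + m ≡ c + d → m ≢ c → m ≢ d → c ≢ d →
                         Prime p → p ≢ 2 → ν p c ≢ ν p m → NonCollinearPrime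
  double-collision-odd {m} {c} {d} {p} m∈ c∈ d∈ m+m≡c+d m≢c m≢d c≢d p-prime p≢2 νc≢νm = unless-collinear p-prime ¬collinear
    where
    ¬collinear : ¬ Collinear (ν̂ p) A
    ¬collinear collinear = [ m≢c ∘ ν-inj m∈ c∈ ∘ trans νm≡⊓ , m≢d ∘ ν-inj m∈ d∈ ∘ trans νm≡⊓ ]′ (⊓-sel (ν p c) (ν p d))
      where
      ν-inj : ν-Injective p
      ν-inj = ν-injective-on-line p collinear c∈ m∈ νc≢νm
      νm≡⊓ : ν p m ≡ ν p c ⊓ ν p d
      νm≡⊓ = begin
        ν p m             ≡⟨ cong (_+ ν p m) (ν[2]≡0 p-prime p≢2) ⟨
        ν p 2 + ν p m     ≡⟨ ν-double p-prime m {{nz m∈}} ⟨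
        ν p (m + m)       ≡⟨ cong (ν p) m+m≡c+d ⟩
        ν p (c + d)       ≡⟨ ν-sum≡⊓ (prime⇒>1 p-prime) ν-inj c∈ d∈ c≢d ⟩
        ν p c ⊓ ν p d     ∎
        where open ≡-Reasoning

  double-collision-even : ∀ {m c d} → m ∈ A → c ∈ A → d ∈ A → m + m ≡ c + d → m ≢ c → c ≢ d →
                          c * 2 ^ ν 2 m ≡ m * 2 ^ ν 2 c → NonCollinearPrime
  double-collision-even {m} {c} {d} m∈ c∈ d∈ m+m≡c+d m≢c c≢d parts≡ = unless-collinear prime[2] ¬collinear
    where
    instance
      m≢0 : NonZero m
      m≢0 = nz m∈
      2^νm≢0 : NonZero (2 ^ ν 2 m)
      2^νm≢0 = m^n≢0 2 (ν 2 m)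
    νc≢νm : ν 2 c ≢ ν 2 m
    νc≢νm νc≡νm = m≢c (sym (*-cancelʳ-≡ c m (2 ^ ν 2 m) (trans parts≡ (cong (λ e → m * 2 ^ e) νc≡νm))))
    ¬collinear : ¬ Collinear (ν̂ 2) A
    ¬collinear collinear = <-irrefl refl (begin-strict
      c        <⟨ m<m+n c (>-nonZero⁻¹ d {{nz d∈}}) ⟩
      c + d    ≡⟨ m+m≡c+d ⟨
      m + m    ≡⟨ cong (λ n → m + n) (+-identityʳ m) ⟨
      2 * m    ≤⟨ 2m≤c ⟩
      c        ∎)
      where
      open ≤-Reasoning
      ν-inj : ν-Injective 2
      ν-inj = ν-injective-on-line 2 collinear c∈ m∈ νc≢νm
      νm<νc : ν 2 m < ν 2 c
      νm<νc = begin-strict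
        ν 2 m               <⟨ n<1+n (ν 2 m) ⟩
        ν 2 2 + ν 2 m       ≡⟨ ν-double prime[2] m ⟨
        ν 2 (m + m)         ≡⟨ cong (ν 2) m+m≡c+d ⟩
        ν 2 (c + d)         ≡⟨ ν-sum≡⊓ (s≤s (s≤s z≤n)) ν-inj c∈ d∈ c≢d ⟩
        ν 2 c ⊓ ν 2 d       ≤⟨ m⊓n≤m (ν 2 c) (ν 2 d) ⟩
        ν 2 c               ∎
      2m≤c : 2 * m ≤ c
      2m≤c = *-cancelʳ-≤ (2 * m) c (2 ^ ν 2 m) (begin
        2 * m * 2 ^ ν 2 m    ≡⟨ regroup m (2 ^ ν 2 m) ⟩
        m * 2 ^ suc (ν 2 m)  ≤⟨ *-monoʳ-≤ m (^-monoʳ-≤ 2 νm<νc) ⟩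
        m * 2 ^ ν 2 c        ≡⟨ parts≡ ⟨
        c * 2 ^ ν 2 m        ∎)
        where
        regroup : ∀ m t → 2 * m * t ≡ m * (2 * t)
        regroup = solve-∀

  -- c * 2 ^ ν 2 m ≡ m * 2 ^ ν 2 c says that c and m have the same odd part.
  double-collision : ∀ {m c d} → m ∈ A → c ∈ A → d ∈ A → m + m ≡ c + d → m ≢ c → m ≢ d → c ≢ d → NonCollinearPrime
  double-collision {m} {c} {d} m∈ c∈ d∈ m+m≡c+d m≢c m≢d c≢d = by-odd-parts (c * 2 ^ ν 2 m ≟ m * 2 ^ ν 2 c)
    where
    instance
      m≢0 : NonZero m
      m≢0 = nz m∈
      c≢0 : NonZero c
      c≢0 = nz c∈
      c*2^νm≢0 : NonZero (c * 2 ^ ν 2 m)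
      c*2^νm≢0 = m*n≢0 c (2 ^ ν 2 m) {{c≢0}} {{m^n≢0 2 (ν 2 m)}}
      m*2^νc≢0 : NonZero (m * 2 ^ ν 2 c)
      m*2^νc≢0 = m*n≢0 m (2 ^ ν 2 c) {{m≢0}} {{m^n≢0 2 (ν 2 c)}}
    odd-prime : ∀ {p} → Prime p → ν p (c * 2 ^ ν 2 m) ≢ ν p (m * 2 ^ ν 2 c) → Dec (p ≡ 2) → NonCollinearPrime
    odd-prime p-prime ν≢ (yes refl) =
      contradiction (trans (ν₂-*2^ c (ν 2 m)) (trans (+-comm (ν 2 c) (ν 2 m)) (sym (ν₂-*2^ m (ν 2 c))))) ν≢
    odd-prime p-prime ν≢ (no p≢2) = double-collision-odd m∈ c∈ d∈ m+m≡c+d m≢c m≢d c≢d p-prime p≢2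
      λ νc≡νm → ν≢ (trans (ν-*2^ p-prime p≢2 c (ν 2 m)) (trans νc≡νm (sym (ν-*2^ p-prime p≢2 m (ν 2 c)))))
    separating-prime : (∃[ p ] Prime p × ν p (c * 2 ^ ν 2 m) ≢ ν p (m * 2 ^ ν 2 c)) → NonCollinearPrime
    separating-prime (p , p-prime , ν≢) = odd-prime p-prime ν≢ (p ≟ 2)
    by-odd-parts : Dec (c * 2 ^ ν 2 m ≡ m * 2 ^ ν 2 c) → NonCollinearPrime
    by-odd-parts (yes parts≡) = double-collision-even m∈ c∈ d∈ m+m≡c+d m≢c c≢d parts≡
    by-odd-parts (no parts≢) = separating-prime (≢⇒ν≢ (c * 2 ^ ν 2 m) (m * 2 ^ ν 2 c) parts≢)

  collision⇒nonCollinearPrime : Collision A → NonCollinearPrime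
  collision⇒nonCollinearPrime (collision {a} {b} {c} {d} a∈ b∈ c∈ d∈ a+b≡c+d ¬same) = by-cases (a ≟ b) (c ≟ d)
    where
    double-injective : ∀ {m n} → m + m ≡ n + n → m ≡ n
    double-injective {m} {n} m+m≡n+n =
      *-cancelˡ-≡ m n 2 (trans (cong (λ x → m + x) (+-identityʳ m)) (trans m+m≡n+n (sym (cong (λ x → n + x) (+-identityʳ n)))))
    by-cases : Dec (a ≡ b) → Dec (c ≡ d) → NonCollinearPrime
    by-cases (no a≢b) (no c≢d) = distinct-collision a∈ b∈ c∈ d∈ a+b≡c+d ¬same a≢b c≢d
    by-cases (yes refl) (no c≢d) = double-collision a∈ c∈ d∈ a+b≡c+d (¬same ∘ common⇒samePair a+b≡c+d ∘ inj₁ ∘ inj₁)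
                                                     (¬same ∘ common⇒samePair a+b≡c+d ∘ inj₁ ∘ inj₂) c≢d
    by-cases (no a≢b) (yes refl) = double-collision c∈ a∈ b∈ (sym a+b≡c+d) (¬same ∘ common⇒samePair a+b≡c+d ∘ inj₁ ∘ inj₁ ∘ sym)
                                                     (¬same ∘ common⇒samePair a+b≡c+d ∘ inj₂ ∘ inj₁ ∘ sym) a≢b
    by-cases (yes refl) (yes refl) = contradiction (common⇒samePair a+b≡c+d (inj₁ (inj₁ (double-injective a+b≡c+d)))) ¬same

small-product-set⇒Sidon : ∀ A → Unique A → All NonZero A → card* A + 4 ≤ 3 * length A → IsSidon A
small-product-set⇒Sidon A A! A≢0 small = [ id , ⊥-elim ∘ no-prime ∘ collision⇒nonCollinearPrime ]′ (sidon-or-collision A)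
  where
  open CollisionPrime A A! A≢0
  no-prime : NonCollinearPrime → ⊥
  no-prime (p , p-prime , nc) =
    <⇒≱ (+-monoʳ-< (card* A) (n<1+n 3)) (≤-trans small (card*≥3k∸3 (ν̂ p) (ν̂-hom p-prime) (length A) A refl faithful nc))

3k∸3≤triangle : ∀ k → 3 * k ∸ 3 ≤ (k * k + k) / 2
3k∸3≤triangle 0 = z≤n
3k∸3≤triangle 1 = z≤n
3k∸3≤triangle 2 = ≤-refl
3k∸3≤triangle k@(suc (suc (suc j))) = begin
  3 * k ∸ 3                            ≡⟨ m*n/n≡m (3 * k ∸ 3) 2 ⟨
  (3 * k ∸ 3) * 2 / 2                  ≤⟨ /-monoˡ-≤ 2 (m≤m+n ((3 * k ∸ 3) * 2) (j * j + j)) ⟩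
  ((3 * k ∸ 3) * 2 + (j * j + j)) / 2  ≡⟨ cong (_/ 2) (expand j) ⟩
  (k * k + k) / 2                      ∎
  where
  open ≤-Reasoning
  -- 3 * k ∸ 3 reduces to j + (k + (k + 0)).
  expand : ∀ j → (j + (3 + j + (3 + j + 0))) * 2 + (j * j + j) ≡ (3 + j) * (3 + j) + (3 + j)
  expand = solve-∀

corollary2p5 : ((A : List ℕ) → Unique A → All NonZero A →
                  card* A + 4 ≤ 3 * length A →
                  card+ A ≡ (length A * length A + length A) / 2)
               × ((k : ℕ) → 1 ≤ k → (A : List ℕ) → Unique A → All NonZero A →
                  length A ≡ k → 3 * k ∸ 3 ≤ card+ A ⊔ card* A)
corollary2p5 = small-product-set⇒triangle , 3k∸3≤max
  where
  small-product-set⇒triangle : (A : List ℕ) → Unique A → All NonZero A → card* A + 4 ≤ 3 * length A →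
                               card+ A ≡ (length A * length A + length A) / 2
  small-product-set⇒triangle A A! A≢0 small = card+-Sidon A! (small-product-set⇒Sidon A A! A≢0 small)
  3k∸3≤max : (k : ℕ) → 1 ≤ k → (A : List ℕ) → Unique A → All NonZero A →
             length A ≡ k → 3 * k ∸ 3 ≤ card+ A ⊔ card* A
  3k∸3≤max _ _ A A! A≢0 refl with card* A + 4 ≤? 3 * length A
  ... | yes small = ≤-trans (3k∸3≤triangle (length A))
                            (≤-trans (≤-reflexive (sym (small-product-set⇒triangle A A! A≢0 small))) (m≤m⊔n (card+ A) (card* A)))
  ... | no large = ≤-trans (m≤n+o⇒m∸n≤o (3 * length A) 3 (subst (3 * length A ≤_) (+-comm (card* A) 3) 3k≤c+3))
                           (m≤n⊔m (card+ A) (card* A))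
    where
    3k≤c+3 : 3 * length A ≤ card* A + 3
    3k≤c+3 = ≤-pred (subst (suc (3 * length A) ≤_) (+-suc (card* A) 3) (≰⇒> large))
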